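{- Let $A$ and $B$ be time series, let $d_{A,B}$ be a dissimilarity function with nonnegative integer values, let $c=\max_{i,j}d_{A,B}(i,j)$, and let $R_{A,B}$ be the weighted integer sequence defined in the context. For any two elements $q,q'$ of $R_{A,B}$ with $f(q)<f(q')$, the subsequence $q\circ q'$ of $R_{A,B}$ is a maximal increasing subsequence of $R_{A,B}[f(q):f(q')]$ if and only if all of $\lceil i_q\rceil\le i_{q'}$, $\lceil j_q\rceil\le j_{q'}$ and $(i_{q'}-i_q)+(j_{q'}-j_q)=1$ hold.
   Context: Sequences are 1-indexed; for a sequence $S$, $|S|$ is its length, $S[i]$ its $i$-th element, $S[a:b]=S[a]\circ\cdots\circ S[b]$, $\circ$ is concatenation. A subsequence of $S$ is $S[i_1]\circ\cdots\circ S[i_\ell]$ with $\ell\ge1$ and $i_1<\cdots<i_\ell$. A time series is a nonempty finite sequence; for time series $A,B$, $d_{A,B}(i,j)$ ($1\le i\le|A|$, $1\le j\le|B|$) is a nonnegative integer. For a sequence $S$ of integers, a subsequence is increasing if each element other than the last is less than the next one. An increasing subsequence $T$ of $S$ is maximal if $T$ is the only increasing subsequence of $S$ that has $T$ as a subsequence. The sequence $R_{A,B}$ has length $|A||B|+(|A|-1)(|B|-1)$ and consists of distinct weighted integers. For $1\le i\le|A|$, $1\le j\le|B|$: $r(i,j)=(j-1)(2|A|-1)+i$, occurring at position $f(r(i,j))=(i-1)(2|B|-1)+j$ of $R_{A,B}$, with weight $c-d_{A,B}(i,j)$. For $2\le i\le|A|$, $2\le j\le|B|$: $\tilde r(i,j)=(j-1)(2|A|-1)-i+2$,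 occurring at position $f(\tilde r(i,j))=(i-1)(2|B|-1)-j+2$, with weight $c$. These positions are exactly $1,\dots,|R_{A,B}|$. For an element $q$ of $R_{A,B}$, $f(q)$ denotes its position. For $q=r(i,j)$ put $i_q=i$, $j_q=j$; for $q=\tilde r(i,j)$ put $i_q=i-0.5$, $j_q=j-0.5$. -}

module Defs where

open import Data.Nat using (ℕ; zero; suc; _+_; _*_; _∸_; _≤_; _<_; _<ᵇ_; _⊔_)
open import Data.Integer using (ℤ; +_) renaming (_-_ to _-ℤ_; _+_ to _+ℤ_)
open import Data.Fin using (Fin; toℕ)
open import Data.Bool using (if_then_else_)
open import Data.List using (List; []; _∷_; _++_; map; concatMap; upTo; allFin; foldr; take; drop)
open import Data.List.Relation.Binary.Sublist.Propositional using (_⊆_)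
open import Data.List.Relation.Unary.Linked using (Linked)
open import Data.Product using (_×_; _,_; proj₁)
open import Relation.Binary.PropositionalEquality using (_≡_; _≢_)

-- Setting: |A| = n, |B| = m, and the dissimilarity d_{A,B} is given as
-- d : Fin n → Fin m → ℕ with 0-based indices (d i j = d_{A,B}(i+1, j+1)).
-- The actual values of A and B play no role beyond their lengths and d.

cmax : (n m : ℕ) → (Fin n → Fin m → ℕ) → ℕ
cmax n m d = foldr _⊔_ 0 (concatMap (λ i → map (λ j → d i j) (allFin m)) (allFin n))

-- A weighted integer: (value , weight).  All values here are positive,
-- so we use ℕ for them.
WInt : Set
WInt = ℕ × ℕ

rval : (n i j : ℕ) → ℕ
rval n i j = (j ∸ 1) * (2 * n ∸ 1) + i

-- r~(i,j) = (j-1)(2|A|-1)-i+2   (1-based, 2 ≤ i ≤ n, 2 ≤ j; always ≥ n+1 > 0)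
rtval : (n i j : ℕ) → ℕ
rtval n i j = ((j ∸ 1) * (2 * n ∸ 1) + 2) ∸ i

-- Elements of R_{A,B}, with 0-based Fin indices:
--   r i j       stands for r(i+1, j+1)
--   rt i j _ _  stands for r~(i+1, j+1), requiring 2 ≤ i+1 and 2 ≤ j+1.
data Elem (n m : ℕ) : Set where
  r  : Fin n → Fin m → Elem n m
  rt : (i : Fin n) (j : Fin m) → 1 ≤ toℕ i → 1 ≤ toℕ j → Elem n m

module _ (n m : ℕ) (d : Fin n → Fin m → ℕ) where

  c : ℕ
  c = cmax n m d

  entry : Elem n m → WInt
  entry (r i j)        = rval n (suc (toℕ i)) (suc (toℕ j)) , c ∸ d i j
  entry (rt i j _ _)   = rtval n (suc (toℕ i)) (suc (toℕ j)) , c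

  -- position f(q) in R_{A,B} (1-based)
  f : Elem n m → ℕ
  f (r i j)      = toℕ i * (2 * m ∸ 1) + suc (toℕ j)
  f (rt i j _ _) = (toℕ i * (2 * m ∸ 1) + 2) ∸ suc (toℕ j)

  -- The sequence R_{A,B} listed in order of positions: for i = 1..n, the
  -- block r(i,1),...,r(i,m) at positions (i-1)(2m-1)+1..(i-1)(2m-1)+m,
  -- followed (if i < n) by r~(i+1,m), r~(i+1,m-1), ..., r~(i+1,2) at
  -- positions (i-1)(2m-1)+m+1 .. i(2m-1).
  R : List WInt
  R = concatMap row (allFin n)
    where
    row : Fin n → List WInt
    row i = map (λ j → entry (r i j)) (allFin m)
         ++ (if suc (toℕ i) <ᵇ n
             then map (λ k → rtval n (2 + toℕ i) (m ∸ k) , c) (upTo (m ∸ 1))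
             else [])

  -- 2·i_q and 2·j_q (i_q, j_q are half-integers; we double them)
  twoI : Elem n m → ℤ
  twoI (r i j)      = + (2 * suc (toℕ i))
  twoI (rt i j _ _) = + (2 * suc (toℕ i) ∸ 1)

  twoJ : Elem n m → ℤ
  twoJ (r i j)      = + (2 * suc (toℕ j))
  twoJ (rt i j _ _) = + (2 * suc (toℕ j) ∸ 1)

  ceilI : Elem n m → ℕ
  ceilI (r i j)      = suc (toℕ i)
  ceilI (rt i j _ _) = suc (toℕ i)

  ceilJ : Elem n m → ℕ
  ceilJ (r i j)      = suc (toℕ j)
  ceilJ (rt i j _ _) = suc (toℕ j)

-- segment S[a:b] of a 1-indexed sequence
segment : {A : Set} → List A → ℕ → ℕ → List A
segment S a b = drop (a ∸ 1) (take b S)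

IsSubseq : List WInt → List WInt → Set
IsSubseq T S = (T ⊆ S) × (T ≢ [])

Increasing : List WInt → Set
Increasing T = Linked (λ x y → proj₁ x < proj₁ y) T

IsMaximalIncreasing : List WInt → List WInt → Set
IsMaximalIncreasing T S =
  IsSubseq T S × Increasing T ×
  (∀ U → IsSubseq U S → Increasing U → T ⊆ U → U ≡ T)

-- Give every element of R_{A,B} a position key and a value key (0-based indices): the grid
-- point r(i,j) has keys (i, j) and (j, i), the cell centre r̃(i,j) has keys
-- (i-1, 2|B|-1-j) and (j-1, 2|A|-1-i). Positions and values are mixed-radix encodings of
-- these keys with all second digits below 2|B|-1 resp. 2|A|-1, so both orders are
-- lexicographic. The pair q ∘ q′ is a maximal increasing subsequence of R[f(q):f(q′)]
-- exactly when no element lies strictly between q and q′ both in position and in value.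
-- Comparing keys, every pair other than the four unit moves r(i,j) → r(i,j+1),
-- r(i,j) → r(i+1,j), r(i,j) → r̃(i+1,j+1) and r̃(i,j) → r(i,j) has a grid point in between,
-- and these four moves are exactly the pairs satisfying the half-integer conditions.

module Submission where

open import Defs
open import Data.Nat using (ℕ; zero; suc; pred; _+_; _*_; _∸_; _≤_; _<_; _<ᵇ_; z≤n; s≤s; s≤s⁻¹; s<s⁻¹;
                            >-nonZero)
open import Data.Nat.Properties
open import Data.Nat.Tactic.RingSolver using (solve-∀)
open import Data.Integer using (ℤ; +_) renaming (_≤_ to _≤ℤ_; _-_ to _-ℤ_; _+_ to _+ℤ_)
import Data.Integer as ℤ
open import Data.Integer.Properties using (+-injective; drop‿+≤+)
open import Data.Integer.Tactic.RingSolver using () renaming (solve-∀ to solve-∀ℤ)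
open import Data.Fin using (Fin; toℕ; fromℕ<)
import Data.Fin as Fin
open import Data.Fin.Properties using (toℕ<n; toℕ-fromℕ<)
open import Data.Bool using (true; if_then_else_; T)
open import Data.Unit using (tt)
open import Data.Empty using (⊥; ⊥-elim)
open import Data.Product using (_×_; _,_; proj₁; proj₂; ∃; swap; uncurry)
open import Data.Product.Relation.Binary.Lex.Strict using (×-Lex)
open import Data.Sum using (_⊎_; inj₁; inj₂)
import Data.Sum as Sum
open import Data.List using (List; []; _∷_; _++_; [_]; map; concat; tabulate; applyUpTo; upTo; allFin;
                             length; take; drop)
open import Data.List.Properties
  using (map-tabulate; length-++; length-map; length-tabulate; length-applyUpTo)
open import Data.List.Membership.Propositional using (_∈_)
open import Data.List.Membership.Propositional.Properties using (∈-++⁻)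
open import Data.List.Relation.Unary.Any using (here; there)
open import Data.List.Relation.Unary.All using (All; _∷_)
import Data.List.Relation.Unary.All as All
open import Data.List.Relation.Unary.AllPairs using (_∷_)
open import Data.List.Relation.Unary.Linked using ([-]; _∷_; tail)
open import Data.List.Relation.Unary.Linked.Properties using (Linked⇒AllPairs)
open import Data.List.Relation.Binary.Sublist.Propositional
  using (_⊆_; []; _∷_; _∷ʳ_; ⊆-refl; lookup; from∈)
open import Data.List.Relation.Binary.Sublist.Propositional.Properties using (++⁺ˡ; ++⁺)
open import Function using (_∘_)
open import Function.Bundles using (_⇔_; mk⇔; Equivalence)
open import Function.Construct.Composition using (_⇔-∘_)
open import Relation.Nullary using (¬_)
open import Relation.Binary using (Rel; tri<; tri≈; tri>)
open import Relation.Binary.PropositionalEquality hiding ([_]; J)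

infix 4 _[_]=_

data _[_]=_ {A : Set} : List A → ℕ → A → Set where
  here  : ∀ {x xs} → x ∷ xs [ 0 ]= x
  there : ∀ {x xs k y} → xs [ k ]= y → x ∷ xs [ suc k ]= y

module _ {A : Set} where

  take-suc-[]= : ∀ {xs : List A} {k x} → xs [ k ]= x → take (suc k) xs ≡ take k xs ++ [ x ]
  take-suc-[]= here      = refl
  take-suc-[]= (there p) = cong (_ ∷_) (take-suc-[]= p)

  drop-take-[]= : ∀ {xs : List A} {a b u v} → xs [ a ]= u → xs [ b ]= v → a < b →
                  drop a (take (suc b) xs) ≡ u ∷ drop (suc a) (take b xs) ++ [ v ]
  drop-take-[]= here      (there q) _       = cong (_ ∷_) (take-suc-[]= q)
  drop-take-[]= (there p) (there q) (s≤s a<b) = drop-take-[]= p q a<b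

  ∈-drop-take⁻ : ∀ (xs : List A) a b {w} → w ∈ drop a (take b xs) →
                 ∃ λ k → a ≤ k × k < b × xs [ k ]= w
  ∈-drop-take⁻ (x ∷ xs) zero    (suc b) (here refl) = 0 , z≤n , s≤s z≤n , here
  ∈-drop-take⁻ (x ∷ xs) zero    (suc b) (there w∈) =
    let k , _ , k<b , p = ∈-drop-take⁻ xs zero b w∈ in suc k , z≤n , s≤s k<b , there p
  ∈-drop-take⁻ (x ∷ xs) (suc a) (suc b) w∈ =
    let k , a≤k , k<b , p = ∈-drop-take⁻ xs a b w∈ in suc k , s≤s a≤k , s≤s k<b , there p

  ∈-drop-take⁺ : ∀ {xs : List A} {k w} a b → xs [ k ]= w → a ≤ k → k < b → w ∈ drop a (take b xs)
  ∈-drop-take⁺ zero    (suc b) here      z≤n       (s≤s _)   = here refl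
  ∈-drop-take⁺ zero    (suc b) (there p) z≤n       (s≤s k<b) = there (∈-drop-take⁺ zero b p z≤n k<b)
  ∈-drop-take⁺ (suc a) (suc b) (there p) (s≤s a≤k) (s≤s k<b) = ∈-drop-take⁺ a b p a≤k k<b

  []=-++⁺ˡ : ∀ {xs ys : List A} {k w} → xs [ k ]= w → xs ++ ys [ k ]= w
  []=-++⁺ˡ here      = here
  []=-++⁺ˡ (there p) = there ([]=-++⁺ˡ p)

  []=-++⁺ʳ : ∀ (xs : List A) {ys k w} → ys [ k ]= w → xs ++ ys [ length xs + k ]= w
  []=-++⁺ʳ []       p = p
  []=-++⁺ʳ (x ∷ xs) p = there ([]=-++⁺ʳ xs p)

  []=-++⁻ : ∀ (xs : List A) {ys k w} → xs ++ ys [ k ]= w →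
            xs [ k ]= w ⊎ ∃ λ t → k ≡ length xs + t × ys [ t ]= w
  []=-++⁻ []       p         = inj₂ (_ , refl , p)
  []=-++⁻ (x ∷ xs) here      = inj₁ here
  []=-++⁻ (x ∷ xs) (there p) with []=-++⁻ xs p
  ... | inj₁ q              = inj₁ (there q)
  ... | inj₂ (t , refl , q) = inj₂ (t , refl , q)

  []=-tabulate⁺ : ∀ {k} (g : Fin k → A) j → tabulate g [ toℕ j ]= g j
  []=-tabulate⁺ g Fin.zero    = here
  []=-tabulate⁺ g (Fin.suc j) = there ([]=-tabulate⁺ (λ z → g (Fin.suc z)) j)

  []=-tabulate⁻ : ∀ {k} (g : Fin k → A) {t w} → tabulate g [ t ]= w → ∃ λ j → t ≡ toℕ j × w ≡ g j
  []=-tabulate⁻ {suc k} g here      = Fin.zero , refl , refl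
  []=-tabulate⁻ {suc k} g (there p) =
    let j , t≡j , w≡gj = []=-tabulate⁻ (λ z → g (Fin.suc z)) p in Fin.suc j , cong suc t≡j , w≡gj

  []=-applyUpTo⁺ : ∀ (g : ℕ → A) {L k} → k < L → applyUpTo g L [ k ]= g k
  []=-applyUpTo⁺ g {suc L} {zero}  _         = here
  []=-applyUpTo⁺ g {suc L} {suc k} (s≤s k<L) = there ([]=-applyUpTo⁺ (λ z → g (suc z)) k<L)

  []=-applyUpTo⁻ : ∀ (g : ℕ → A) {L k w} → applyUpTo g L [ k ]= w → k < L × w ≡ g k
  []=-applyUpTo⁻ g {suc L} here      = s≤s z≤n , refl
  []=-applyUpTo⁻ g {suc L} (there p) =
    let k<L , w≡gk = []=-applyUpTo⁻ (λ z → g (suc z)) p in s≤s k<L , w≡gk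

  private
    block-offset : ∀ {l} L i t → l ≡ L → l + (i * L + t) ≡ suc i * L + t
    block-offset L i t refl = sym (+-assoc L (i * L) t)

  []=-concat⁺ : ∀ {k} (F : Fin k → List A) {L} → (∀ {i j : Fin k} → i Fin.< j → length (F i) ≡ L) →
                ∀ i {t w} → F i [ t ]= w → concat (tabulate F) [ toℕ i * L + t ]= w
  []=-concat⁺ F         len Fin.zero    p = []=-++⁺ˡ p
  []=-concat⁺ F {L} len (Fin.suc i) {t} {w} p =
    subst (concat (tabulate F) [_]= w) (block-offset L (toℕ i) t (len {Fin.zero} {Fin.suc i} (s≤s z≤n)))
      ([]=-++⁺ʳ (F Fin.zero) ([]=-concat⁺ (λ z → F (Fin.suc z)) (λ {i} {j} i<j → len {Fin.suc i} {Fin.suc j} (s≤s i<j))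
                                         i p))

  []=-concat⁻ : ∀ {k} (F : Fin k → List A) {L} → (∀ {i j : Fin k} → i Fin.< j → length (F i) ≡ L) →
                ∀ {p w} → concat (tabulate F) [ p ]= w → ∃ λ i → ∃ λ t → p ≡ toℕ i * L + t × F i [ t ]= w
  []=-concat⁻ {suc k} F {L} len p with []=-++⁻ (F Fin.zero) p
  ... | inj₁ q              = Fin.zero , _ , refl , q
  ... | inj₂ (t , refl , q)
    with []=-concat⁻ (λ z → F (Fin.suc z)) (λ {i} {j} i<j → len {Fin.suc i} {Fin.suc j} (s≤s i<j)) q
  ...   | i , u , refl , q′ =
    Fin.suc i , u , block-offset L (toℕ i) u (len {Fin.zero} {Fin.suc i} (s≤s z≤n)) , q′

module _ {A B : Set} (g : A → B) where

  []=-map⁺ : ∀ {xs k y} → xs [ k ]= y → map g xs [ k ]= g y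
  []=-map⁺ here      = here
  []=-map⁺ (there p) = there ([]=-map⁺ p)

  []=-map⁻ : ∀ {xs k w} → map g xs [ k ]= w → ∃ λ y → xs [ k ]= y × w ≡ g y
  []=-map⁻ {x ∷ xs} here      = x , here , refl
  []=-map⁻ {x ∷ xs} (there p) = let y , q , w≡gy = []=-map⁻ p in y , there q , w≡gy

-- Maximal increasing pairs

increasing⇒head< : ∀ {x xs} → Increasing (x ∷ xs) → All (λ y → proj₁ x < proj₁ y) xs
increasing⇒head< inc with Linked⇒AllPairs (λ p q → <-trans p q) inc
... | x<xs ∷ _ = x<xs

module _ {a b : WInt} where

  private
    Outside : WInt → Set
    Outside w = proj₁ w < proj₁ a ⊎ proj₁ b < proj₁ w

  above-a⇒singleton : ∀ mid {U} → (∀ {w} → w ∈ mid → Outside w) → All (λ u → proj₁ a < proj₁ u) U →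
                      Increasing U → U ⊆ mid ++ [ b ] → b ∈ U → U ≡ [ b ]
  above-a⇒singleton []        _   _           _   (refl ∷ []) _ = refl
  above-a⇒singleton (w ∷ mid) out above       inc (.w ∷ʳ sub) b∈U =
    above-a⇒singleton mid (λ w∈ → out (there w∈)) above inc sub b∈U
  above-a⇒singleton (w ∷ mid) out (a<w ∷ _)   inc (refl ∷ sub) b∈U with out (here refl) | b∈U
  ... | inj₁ w<a | _          = ⊥-elim (<-asym w<a a<w)
  ... | inj₂ b<w | here refl  = ⊥-elim (<-irrefl refl b<w)
  ... | inj₂ b<w | there b∈U′ = ⊥-elim (<-asym b<w (All.lookup (increasing⇒head< inc) b∈U′))

  pair-maximal⁺ : ∀ mid → proj₁ a < proj₁ b → (∀ {w} → w ∈ mid → Outside w) →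
                  IsMaximalIncreasing (a ∷ b ∷ []) (a ∷ mid ++ [ b ])
  pair-maximal⁺ mid a<b out = (refl ∷ ++⁺ˡ mid ⊆-refl , λ ()) , a<b ∷ [-] , maximal
    where
    maximal : ∀ U → IsSubseq U (a ∷ mid ++ [ b ]) → Increasing U → a ∷ b ∷ [] ⊆ U → U ≡ a ∷ b ∷ []
    maximal U (.a ∷ʳ sub , _) _ ab⊆U with ∈-++⁻ mid (lookup sub (lookup ab⊆U (here refl)))
    ... | inj₁ a∈mid with out a∈mid
    ...   | inj₁ a<a = ⊥-elim (<-irrefl refl a<a)
    ...   | inj₂ b<a = ⊥-elim (<-asym a<b b<a)
    maximal U (.a ∷ʳ sub , _) _ ab⊆U | inj₂ (here refl) = ⊥-elim (<-irrefl refl a<b)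
    maximal (.a ∷ U) (refl ∷ sub , _) inc ab⊆U =
      cong (a ∷_) (above-a⇒singleton mid out (increasing⇒head< inc) (tail inc) sub (b∈U ab⊆U))
      where
      b∈U : a ∷ b ∷ [] ⊆ a ∷ U → b ∈ U
      b∈U (_ ∷ʳ s)  = lookup s (there (here refl))
      b∈U (refl ∷ s) = lookup s (here refl)

  pair-maximal⁻ : ∀ mid {w} → IsMaximalIncreasing (a ∷ b ∷ []) (a ∷ mid ++ [ b ]) →
                  w ∈ mid → proj₁ a < proj₁ w → proj₁ w < proj₁ b → ⊥
  pair-maximal⁻ mid {w} (_ , _ , maximal) w∈mid a<w w<b =
    three≢two (maximal (a ∷ w ∷ b ∷ []) (refl ∷ ++⁺ (from∈ w∈mid) ⊆-refl , λ ()) (a<w ∷ w<b ∷ [-])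
                       (refl ∷ w ∷ʳ refl ∷ []))
    where
    three≢two : a ∷ w ∷ b ∷ [] ≡ a ∷ b ∷ [] → ⊥
    three≢two ()

2*m∸1≡m+[m∸1] : ∀ m → 2 * m ∸ 1 ≡ m + (m ∸ 1)
2*m∸1≡m+[m∸1] zero    = refl
2*m∸1≡m+[m∸1] (suc m) = trans (+-suc m (m + 0)) (cong (λ k → suc (m + k)) (+-identityʳ m))

2*m∸1∸j≡m+[m∸suc[j]] : ∀ {m j} → j < m → 2 * m ∸ 1 ∸ j ≡ m + (m ∸ suc j)
2*m∸1∸j≡m+[m∸suc[j]] {m} {j} j<m = begin
  2 * m ∸ 1 ∸ j     ≡⟨ cong (_∸ j) (2*m∸1≡m+[m∸1] m) ⟩
  m + (m ∸ 1) ∸ j   ≡⟨ +-∸-assoc m (<⇒≤pred j<m) ⟩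
  m + (m ∸ 1 ∸ j)   ≡⟨ cong (λ k → m + k) (∸-+-assoc m 1 j) ⟩
  m + (m ∸ suc j)   ∎
  where open ≡-Reasoning

m≤2*m∸1 : ∀ m → m ≤ 2 * m ∸ 1
m≤2*m∸1 m = subst (m ≤_) (sym (2*m∸1≡m+[m∸1] m)) (m≤m+n m _)

m≤2*m∸1∸j : ∀ {m j} → j < m → m ≤ 2 * m ∸ 1 ∸ j
m≤2*m∸1∸j {m} j<m = subst (m ≤_) (sym (2*m∸1∸j≡m+[m∸suc[j]] j<m)) (m≤m+n m _)

[a*K+2]∸suc[t]≡suc[pred[a]*K+[K∸t]] : ∀ {a} K {t} → 1 ≤ a → t ≤ K →
                                      (a * K + 2) ∸ suc t ≡ suc (pred a * K + (K ∸ t))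
[a*K+2]∸suc[t]≡suc[pred[a]*K+[K∸t]] {suc a} K {t} _ t≤K =
  trans (cong (_∸ suc t) split) (m+n∸n≡m _ (suc t))
  where
  rearrange : ∀ x y z → y + z + x + 2 ≡ suc (x + y) + suc z
  rearrange = solve-∀
  split : suc a * K + 2 ≡ suc (a * K + (K ∸ t)) + suc t
  split = trans (cong (λ k → k + a * K + 2) (sym (m∸n+n≡m t≤K))) (rearrange (a * K) (K ∸ t) t)

m∸k≡suc[m∸suc[k]] : ∀ {m k} → k < m → m ∸ k ≡ suc (m ∸ suc k)
m∸k≡suc[m∸suc[k]] k<m = +-∸-assoc 1 k<m

m∸suc[m∸suc[k]]≡k : ∀ {m k} → k < m → m ∸ suc (m ∸ suc k) ≡ k
m∸suc[m∸suc[k]]≡k {m} {k} k<m =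
  trans (sym (pred[m∸n]≡m∸[1+n] m (m ∸ suc k))) (cong pred (m∸[m∸n]≡n k<m))

pred[n]<n : ∀ {n} → 1 ≤ n → pred n < n
pred[n]<n {suc n} _ = n<1+n n

pred<⇒≤ : ∀ {a b} → 1 ≤ a → pred a < b → a ≤ b
pred<⇒≤ {suc a} _ lt = lt

pred-inverse : ∀ {a b} → 1 ≤ b → a ≡ pred b → b ≡ suc a
pred-inverse {b = suc b} _ a≡b = cong suc (sym a≡b)

k<m∸1⇒suc[k]<m : ∀ {k m} → k < m ∸ 1 → suc k < m
k<m∸1⇒suc[k]<m {m = suc m} k<m = s≤s k<m

-- Lexicographic order and mixed-radix encoding

infix 4 _<ₗₑₓ_

_<ₗₑₓ_ : Rel (ℕ × ℕ) _
_<ₗₑₓ_ = ×-Lex _≡_ _<_ _<_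

encode : ℕ → ℕ × ℕ → ℕ
encode K (a , t) = a * K + t

module _ (K : ℕ) where

  encode-mono-< : ∀ {a t b u} → t < K → (a , t) <ₗₑₓ (b , u) → encode K (a , t) < encode K (b , u)
  encode-mono-< {a} {t} {b} {u} t<K (inj₁ a<b) = begin-strict
    a * K + t   <⟨ +-monoʳ-< (a * K) t<K ⟩
    a * K + K   ≡⟨ +-comm (a * K) K ⟩
    suc a * K   ≤⟨ *-monoˡ-≤ K a<b ⟩
    b * K       ≤⟨ m≤m+n (b * K) u ⟩
    b * K + u   ∎
    where open ≤-Reasoning
  encode-mono-< {a} _ (inj₂ (refl , t<u)) = +-monoʳ-< (a * K) t<u

  encode-cancel-< : ∀ {a t b u} → t < K → u < K →
                    encode K (a , t) < encode K (b , u) → (a , t) <ₗₑₓ (b , u)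
  encode-cancel-< {a} {t} {b} {u} t<K u<K lt with <-cmp a b
  ... | tri< a<b _ _ = inj₁ a<b
  ... | tri≈ _ refl _ = inj₂ (refl , +-cancelˡ-< (a * K) t u lt)
  ... | tri> _ _ b<a = ⊥-elim (<-asym lt (encode-mono-< u<K (inj₁ b<a)))

  encode-injective : ∀ {a t b u} → t < K → u < K →
                     encode K (a , t) ≡ encode K (b , u) → (a , t) ≡ (b , u)
  encode-injective {a} {t} {b} {u} t<K u<K e with <-cmp a b
  ... | tri< a<b _ _ = ⊥-elim (<⇒≢ (encode-mono-< t<K (inj₁ a<b)) e)
  ... | tri≈ _ refl _ = cong (a ,_) (+-cancelˡ-≡ (a * K) t u e)
  ... | tri> _ _ b<a = ⊥-elim (<⇒≢ (encode-mono-< u<K (inj₁ b<a)) (sym e))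

≤∧<⇒<ₗₑₓ : ∀ {a t b u} → a ≤ b → t < u → (a , t) <ₗₑₓ (b , u)
≤∧<⇒<ₗₑₓ a≤b t<u with m≤n⇒m<n∨m≡n a≤b
... | inj₁ a<b  = inj₁ a<b
... | inj₂ refl = inj₂ (refl , t<u)

<ₗₑₓ-sndˡ : ∀ {a t t′ b u} → (a , t) <ₗₑₓ (b , u) → t′ < u → (a , t′) <ₗₑₓ (b , u)
<ₗₑₓ-sndˡ (inj₁ a<b)       _    = inj₁ a<b
<ₗₑₓ-sndˡ (inj₂ (a≡b , _)) t′<u = inj₂ (a≡b , t′<u)

<ₗₑₓ-sandwich : ∀ {a t b u v} → (a , t) <ₗₑₓ (b , u) → (b , u) <ₗₑₓ (a , v) → b ≡ a × t < u × u < v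
<ₗₑₓ-sandwich (inj₁ a<b)        (inj₁ b<a)       = ⊥-elim (<-asym a<b b<a)
<ₗₑₓ-sandwich (inj₁ a<b)        (inj₂ (refl , _)) = ⊥-elim (<-irrefl refl a<b)
<ₗₑₓ-sandwich (inj₂ (refl , _)) (inj₁ b<a)       = ⊥-elim (<-irrefl refl b<a)
<ₗₑₓ-sandwich (inj₂ (refl , t<u)) (inj₂ (_ , u<v)) = refl , t<u , u<v

2*suc≤2*suc⇒≤ : ∀ {a b} → 2 * suc a ≤ 2 * suc b → a ≤ b
2*suc≤2*suc⇒≤ le = s≤s⁻¹ (*-cancelˡ-≤ 2 le)

2*suc≤suc[2*]⇒< : ∀ {a b} → 2 * suc a ≤ suc (2 * b) → a < b
2*suc≤suc[2*]⇒< {a} {b} le = *-cancelˡ-< 2 a b (s≤s⁻¹ (subst (_≤ suc (2 * b)) (*-distribˡ-+ 2 1 a) le))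

2*x+k≡2*y+k⇒x≡y : ∀ {x y} k → 2 * x + k ≡ 2 * y + k → x ≡ y
2*x+k≡2*y+k⇒x≡y {x} {y} k e = *-cancelˡ-≡ x y 2 (+-cancelʳ-≡ k _ _ e)

sum-split : ∀ {a a′ b b′} → a ≤ a′ → b ≤ b′ → a′ + b′ ≡ a + b → a′ ≡ a × b′ ≡ b
sum-split {a} a≤a′ b≤b′ e with m≤n⇒m<n∨m≡n a≤a′
... | inj₁ a<a′ = ⊥-elim (<-irrefl (sym e) (+-mono-<-≤ a<a′ b≤b′))
... | inj₂ refl = refl , +-cancelˡ-≡ a _ _ e

step-split : ∀ {a a′ b b′} → a ≤ a′ → b ≤ b′ → a′ + b′ ≡ suc (a + b) →
             (a′ ≡ a × b′ ≡ suc b) ⊎ (a′ ≡ suc a × b′ ≡ b)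
step-split {a} {b = b} a≤a′ b≤b′ e with m≤n⇒m<n∨m≡n a≤a′
... | inj₁ a<a′ = inj₂ (sum-split a<a′ b≤b′ e)
... | inj₂ refl = inj₁ (refl , +-cancelˡ-≡ a _ _ (trans e (sym (+-suc a b))))

Step : (c₁ c₂ a b a′ b′ : ℕ) → Set
Step c₁ c₂ a b a′ b′ = c₁ ≤ a′ × c₂ ≤ b′ × a′ + b′ ≡ 2 + (a + b)

2*suc[a]+2*suc[b]≡2*[a+b]+4 : ∀ a b → 2 * suc a + 2 * suc b ≡ 2 * (a + b) + 4
2*suc[a]+2*suc[b]≡2*[a+b]+4 = solve-∀

suc[2*a]+suc[2*b]≡2*[a+b]+2 : ∀ a b → suc (2 * a) + suc (2 * b) ≡ 2 * (a + b) + 2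
suc[2*a]+suc[2*b]≡2*[a+b]+2 = solve-∀

even-even-step⇔ : ∀ a b a′ b′ →
  Step (2 * suc a) (2 * suc b) (2 * suc a) (2 * suc b) (2 * suc a′) (2 * suc b′)
  ⇔ ((a′ ≡ a × b′ ≡ suc b) ⊎ (a′ ≡ suc a × b′ ≡ b))
even-even-step⇔ a b a′ b′ = mk⇔
  (λ (c₁ , c₂ , e) → step-split (2*suc≤2*suc⇒≤ c₁) (2*suc≤2*suc⇒≤ c₂) (2*x+k≡2*y+k⇒x≡y {a′ + b′} 4
     (trans (sym (2*suc[a]+2*suc[b]≡2*[a+b]+4 a′ b′)) (trans e (target a b)))))
  (λ { (inj₁ (refl , refl)) → ≤-refl , *-monoʳ-≤ 2 (n≤1+n (suc b)) , right a b
     ; (inj₂ (refl , refl)) → *-monoʳ-≤ 2 (n≤1+n (suc a)) , ≤-refl , down a b })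
  where
  target : ∀ a b → 2 + (2 * suc a + 2 * suc b) ≡ 2 * suc (a + b) + 4
  target = solve-∀
  right : ∀ a b → 2 * suc a + 2 * suc (suc b) ≡ 2 + (2 * suc a + 2 * suc b)
  right = solve-∀
  down : ∀ a b → 2 * suc (suc a) + 2 * suc b ≡ 2 + (2 * suc a + 2 * suc b)
  down = solve-∀

even-odd-step⇔ : ∀ a b a′ b′ →
  Step (2 * suc a) (2 * suc b) (2 * suc a) (2 * suc b) (suc (2 * a′)) (suc (2 * b′))
  ⇔ (a′ ≡ suc a × b′ ≡ suc b)
even-odd-step⇔ a b a′ b′ = mk⇔
  (λ (c₁ , c₂ , e) → sum-split (2*suc≤suc[2*]⇒< c₁) (2*suc≤suc[2*]⇒< c₂) (2*x+k≡2*y+k⇒x≡y {a′ + b′} 2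
     (trans (sym (suc[2*a]+suc[2*b]≡2*[a+b]+2 a′ b′)) (trans e (target a b)))))
  (λ { (refl , refl) → n≤1+n _ , n≤1+n _ , diagonal a b })
  where
  target : ∀ a b → 2 + (2 * suc a + 2 * suc b) ≡ 2 * (suc a + suc b) + 2
  target = solve-∀
  diagonal : ∀ a b → suc (2 * suc a) + suc (2 * suc b) ≡ 2 + (2 * suc a + 2 * suc b)
  diagonal = solve-∀

odd-even-step⇔ : ∀ a b a′ b′ →
  Step (2 * suc a) (2 * suc b) (suc (2 * a)) (suc (2 * b)) (2 * suc a′) (2 * suc b′)
  ⇔ (a′ ≡ a × b′ ≡ b)
odd-even-step⇔ a b a′ b′ = mk⇔
  (λ (c₁ , c₂ , e) → sum-split (2*suc≤2*suc⇒≤ c₁) (2*suc≤2*suc⇒≤ c₂) (2*x+k≡2*y+k⇒x≡y {a′ + b′} 4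
     (trans (sym (2*suc[a]+2*suc[b]≡2*[a+b]+4 a′ b′)) (trans e (target a b)))))
  (λ { (refl , refl) → ≤-refl , ≤-refl , diagonal a b })
  where
  target : ∀ a b → 2 + (suc (2 * a) + suc (2 * b)) ≡ 2 * (a + b) + 4
  target = solve-∀
  diagonal : ∀ a b → 2 * suc a + 2 * suc b ≡ 2 + (suc (2 * a) + suc (2 * b))
  diagonal = solve-∀

odd-odd-¬step : ∀ a b a′ b′ →
  ¬ Step (2 * suc a) (2 * suc b) (suc (2 * a)) (suc (2 * b)) (suc (2 * a′)) (suc (2 * b′))
odd-odd-¬step a b a′ b′ (c₁ , c₂ , e) =
  <-irrefl refl (subst (_≤ suc (a + b)) (cong suc (+-suc a b)) (subst (suc a + suc b ≤_) sum
    (+-mono-≤ (2*suc≤suc[2*]⇒< {a} {a′} c₁) (2*suc≤suc[2*]⇒< {b} {b′} c₂))))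
  where
  target : ∀ a b → 2 + (suc (2 * a) + suc (2 * b)) ≡ 2 * suc (a + b) + 2
  target = solve-∀
  sum : a′ + b′ ≡ suc (a + b)
  sum = 2*x+k≡2*y+k⇒x≡y {a′ + b′} {suc (a + b)} 2
          (trans (sym (suc[2*a]+suc[2*b]≡2*[a+b]+2 a′ b′)) (trans e (target a b)))

difference-sum≡2⇔ : ∀ a b a′ b′ → ((+ a′ -ℤ + a) +ℤ (+ b′ -ℤ + b) ≡ + 2) ⇔ (a′ + b′ ≡ 2 + (a + b))
difference-sum≡2⇔ a b a′ b′ = mk⇔ to from
  where
  rearrange : ∀ (x y z w : ℤ) → (x -ℤ y) +ℤ (z -ℤ w) ≡ (x +ℤ z) -ℤ (y +ℤ w)
  rearrange = solve-∀ℤ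
  sub-add : ∀ (x y : ℤ) → (x -ℤ y) +ℤ y ≡ x
  sub-add = solve-∀ℤ
  add-sub : ∀ (x y : ℤ) → (x +ℤ y) -ℤ y ≡ x
  add-sub = solve-∀ℤ
  rearranged : (+ a′ -ℤ + a) +ℤ (+ b′ -ℤ + b) ≡ + (a′ + b′) -ℤ + (a + b)
  rearranged = rearrange (+ a′) (+ a) (+ b′) (+ b)
  to : (+ a′ -ℤ + a) +ℤ (+ b′ -ℤ + b) ≡ + 2 → a′ + b′ ≡ 2 + (a + b)
  to e = +-injective (begin
    + (a′ + b′)                                ≡⟨ sym (sub-add (+ (a′ + b′)) (+ (a + b))) ⟩
    (+ (a′ + b′) -ℤ + (a + b)) +ℤ + (a + b)    ≡⟨ cong (_+ℤ + (a + b)) (trans (sym rearranged) e) ⟩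
    + (2 + (a + b))                            ∎)
    where open ≡-Reasoning
  from : a′ + b′ ≡ 2 + (a + b) → (+ a′ -ℤ + a) +ℤ (+ b′ -ℤ + b) ≡ + 2
  from e = begin
    (+ a′ -ℤ + a) +ℤ (+ b′ -ℤ + b)    ≡⟨ rearranged ⟩
    + (a′ + b′) -ℤ + (a + b)          ≡⟨ cong (λ k → + k -ℤ + (a + b)) e ⟩
    (+ 2 +ℤ + (a + b)) -ℤ + (a + b)   ≡⟨ add-sub (+ 2) (+ (a + b)) ⟩
    + 2                               ∎
    where open ≡-Reasoning

-- The grid structure of R_{A,B}

module Grid (n m : ℕ) (d : Fin n → Fin m → ℕ) where

  M N : ℕ
  M = 2 * m ∸ 1
  N = 2 * n ∸ 1

  pos : Elem n m → ℕ
  pos = f n m d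

  val : Elem n m → ℕ
  val x = proj₁ (entry n m d x)

  posKey valKey : Elem n m → ℕ × ℕ
  posKey (r i j)      = toℕ i , toℕ j
  posKey (rt i j _ _) = pred (toℕ i) , M ∸ toℕ j
  valKey (r i j)      = toℕ j , toℕ i
  valKey (rt i j _ _) = pred (toℕ j) , N ∸ toℕ i

  offset : Elem n m → ℕ
  offset x = encode M (posKey x)

  j≤M : ∀ (j : Fin m) → toℕ j ≤ M
  j≤M j = ≤-trans (<⇒≤ (toℕ<n j)) (m≤2*m∸1 m)

  i≤N : ∀ (i : Fin n) → toℕ i ≤ N
  i≤N i = ≤-trans (<⇒≤ (toℕ<n i)) (m≤2*m∸1 n)

  n≤N∸i : ∀ (i : Fin n) → n ≤ N ∸ toℕ i
  n≤N∸i i = m≤2*m∸1∸j (toℕ<n i)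

  m≤M∸j : ∀ (j : Fin m) → m ≤ M ∸ toℕ j
  m≤M∸j j = m≤2*m∸1∸j (toℕ<n j)

  posKey-digit<M : ∀ x → proj₂ (posKey x) < M
  posKey-digit<M (r i j)        = <-≤-trans (toℕ<n j) (m≤2*m∸1 m)
  posKey-digit<M (rt i j _ 1≤j) = ∸-monoʳ-< 1≤j (j≤M j)

  valKey-digit<N : ∀ x → proj₂ (valKey x) < N
  valKey-digit<N (r i j)        = <-≤-trans (toℕ<n i) (m≤2*m∸1 n)
  valKey-digit<N (rt i j 1≤i _) = ∸-monoʳ-< 1≤i (i≤N i)

  pos≡ : ∀ x → pos x ≡ suc (offset x)
  pos≡ (r i j)          = +-suc (toℕ i * M) (toℕ j)
  pos≡ (rt i j 1≤i _)   = [a*K+2]∸suc[t]≡suc[pred[a]*K+[K∸t]] M 1≤i (j≤M j)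

  val≡ : ∀ x → val x ≡ suc (encode N (valKey x))
  val≡ (r i j)          = +-suc (toℕ j * N) (toℕ i)
  val≡ (rt i j _ 1≤j)   = [a*K+2]∸suc[t]≡suc[pred[a]*K+[K∸t]] N 1≤j (i≤N i)

  pos<⇒posKey< : ∀ x y → pos x < pos y → posKey x <ₗₑₓ posKey y
  pos<⇒posKey< x y lt =
    encode-cancel-< M (posKey-digit<M x) (posKey-digit<M y) (s<s⁻¹ (subst₂ _<_ (pos≡ x) (pos≡ y) lt))

  posKey<⇒pos< : ∀ x y → posKey x <ₗₑₓ posKey y → pos x < pos y
  posKey<⇒pos< x y lt =
    subst₂ _<_ (sym (pos≡ x)) (sym (pos≡ y)) (s≤s (encode-mono-< M (posKey-digit<M x) lt))

  val<⇒valKey< : ∀ x y → val x < val y → valKey x <ₗₑₓ valKey y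
  val<⇒valKey< x y lt =
    encode-cancel-< N (valKey-digit<N x) (valKey-digit<N y) (s<s⁻¹ (subst₂ _<_ (val≡ x) (val≡ y) lt))

  valKey<⇒val< : ∀ x y → valKey x <ₗₑₓ valKey y → val x < val y
  valKey<⇒val< x y lt =
    subst₂ _<_ (sym (val≡ x)) (sym (val≡ y)) (s≤s (encode-mono-< N (valKey-digit<N x) lt))

  valKey-injective : ∀ x y → valKey x ≡ valKey y → posKey x ≡ posKey y
  valKey-injective (r i j)      (r i′ j′)        e = cong swap e
  valKey-injective (r i j)      (rt i′ j′ _ _)   e =
    ⊥-elim (<-irrefl (cong proj₂ e) (<-≤-trans (toℕ<n i) (n≤N∸i i′)))
  valKey-injective (rt i j _ _) (r i′ j′)        e =
    ⊥-elim (<-irrefl (sym (cong proj₂ e)) (<-≤-trans (toℕ<n i′) (n≤N∸i i)))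
  valKey-injective (rt i j _ 1≤j) (rt i′ j′ _ 1≤j′) e =
    cong₂ _,_ (cong pred (∸-cancelˡ-≡ (i≤N i) (i≤N i′) (cong proj₂ e)))
              (cong (M ∸_) (pred-injective {{>-nonZero 1≤j}} {{>-nonZero 1≤j′}} (cong proj₁ e)))

  val-injective : ∀ x y → val x ≡ val y → pos x ≡ pos y
  val-injective x y e = begin
    pos x                        ≡⟨ pos≡ x ⟩
    suc (offset x)               ≡⟨ cong (suc ∘ encode M) (valKey-injective x y valKey≡) ⟩
    suc (offset y)               ≡⟨ sym (pos≡ y) ⟩
    pos y                        ∎
    where
    open ≡-Reasoning
    valKey≡ : valKey x ≡ valKey y
    valKey≡ = encode-injective N (valKey-digit<N x) (valKey-digit<N y)
                (suc-injective (trans (sym (val≡ x)) (trans e (val≡ y))))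

  rtAt : ∀ {I J} → I < n → J < m → 1 ≤ I → 1 ≤ J → Elem n m
  rtAt I<n J<m 1≤I 1≤J =
    rt (fromℕ< I<n) (fromℕ< J<m) (subst (1 ≤_) (sym (toℕ-fromℕ< I<n)) 1≤I)
                                 (subst (1 ≤_) (sym (toℕ-fromℕ< J<m)) 1≤J)

  posKey-rtAt : ∀ {I J} (I<n : I < n) (J<m : J < m) 1≤I 1≤J →
                posKey (rtAt I<n J<m 1≤I 1≤J) ≡ (pred I , M ∸ J)
  posKey-rtAt I<n J<m _ _ = cong₂ (λ a b → pred a , M ∸ b) (toℕ-fromℕ< I<n) (toℕ-fromℕ< J<m)

  entry-rtAt : ∀ {I J} (I<n : I < n) (J<m : J < m) 1≤I 1≤J →
               entry n m d (rtAt I<n J<m 1≤I 1≤J) ≡ (rtval n (suc I) (suc J) , c n m d)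
  entry-rtAt I<n J<m _ _ =
    cong₂ (λ a b → rtval n (suc a) (suc b) , c n m d) (toℕ-fromℕ< I<n) (toℕ-fromℕ< J<m)

  points : Fin n → List WInt
  points i = map (λ j → entry n m d (r i j)) (allFin m)

  centre : Fin n → ℕ → WInt
  centre i k = rtval n (2 + toℕ i) (m ∸ k) , c n m d

  centres : Fin n → List WInt
  centres i = if suc (toℕ i) <ᵇ n then map (centre i) (upTo (m ∸ 1)) else []

  row : Fin n → List WInt
  row i = points i ++ centres i

  R≡concat-rows : R n m d ≡ concat (tabulate row)
  R≡concat-rows = cong concat (map-tabulate (λ i → i) row)

  centres-nonlast : ∀ {i} → suc (toℕ i) < n → centres i ≡ map (centre i) (upTo (m ∸ 1))
  centres-nonlast {i} lt with suc (toℕ i) <ᵇ n | <⇒<ᵇ lt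
  ... | true | _ = refl

  []=-centres⁻ : ∀ i {k w} → centres i [ k ]= w → suc (toℕ i) < n × k < m ∸ 1 × w ≡ centre i k
  []=-centres⁻ i p with suc (toℕ i) <ᵇ n in nonlast
  ... | true =
    let _ , q , w≡ = []=-map⁻ (centre i) p
        k<m∸1 , y≡k = []=-applyUpTo⁻ (λ k → k) q
    in <ᵇ⇒< (suc (toℕ i)) n (subst T (sym nonlast) tt) , k<m∸1 , trans w≡ (cong (centre i) y≡k)

  length-points : ∀ i → length (points i) ≡ m
  length-points i = trans (length-map _ (allFin m)) (length-tabulate (λ j → j))

  row-length : ∀ {i i′ : Fin n} → i Fin.< i′ → length (row i) ≡ M
  row-length {i} {i′} i<i′ = begin
    length (points i ++ centres i)          ≡⟨ length-++ (points i) ⟩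
    length (points i) + length (centres i)
      ≡⟨ cong₂ _+_ (length-points i) (cong length (centres-nonlast nonlast)) ⟩
    m + length (map (centre i) (upTo (m ∸ 1)))
      ≡⟨ cong (λ k → m + k) (trans (length-map _ (upTo (m ∸ 1))) (length-applyUpTo _ (m ∸ 1))) ⟩
    m + (m ∸ 1)                             ≡⟨ sym (2*m∸1≡m+[m∸1] m) ⟩
    M                                       ∎
    where
    open ≡-Reasoning
    nonlast : suc (toℕ i) < n
    nonlast = <-≤-trans (s≤s i<i′) (toℕ<n i′)

  []=-R-row : ∀ i {t w} → row i [ t ]= w → R n m d [ toℕ i * M + t ]= w
  []=-R-row i {t} {w} p =
    subst (_[ toℕ i * M + t ]= w) (sym R≡concat-rows) ([]=-concat⁺ row row-length i p)

  []=-R⁺ : ∀ x → R n m d [ offset x ]= entry n m d x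
  []=-R⁺ (r i j)            = []=-R-row i ([]=-++⁺ˡ ([]=-map⁺ _ ([]=-tabulate⁺ (λ j → j) j)))
  []=-R⁺ (rt i j 1≤i 1≤j) = subst₂ (R n m d [_]=_) index value ([]=-R-row i₀ inRow)
    where
    I J k : ℕ
    I = toℕ i
    J = toℕ j
    k = m ∸ suc J
    I-1<n : pred I < n
    I-1<n = ≤-<-trans pred[n]≤n (toℕ<n i)
    i₀ : Fin n
    i₀ = fromℕ< I-1<n
    1+i₀≡I : suc (toℕ i₀) ≡ I
    1+i₀≡I = trans (cong suc (toℕ-fromℕ< I-1<n)) (suc-pred I {{>-nonZero 1≤i}})
    nonlast : suc (toℕ i₀) < n
    nonlast = subst (_< n) (sym 1+i₀≡I) (toℕ<n i)
    inRow : row i₀ [ length (points i₀) + k ]= centre i₀ k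
    inRow = []=-++⁺ʳ (points i₀) (subst (_[ k ]= centre i₀ k) (sym (centres-nonlast nonlast))
              ([]=-map⁺ (centre i₀) ([]=-applyUpTo⁺ (λ k → k) (∸-monoʳ-< (s≤s 1≤j) (toℕ<n j)))))
    index : toℕ i₀ * M + (length (points i₀) + k) ≡ pred I * M + (M ∸ J)
    index = cong₂ (λ a b → a * M + b) (toℕ-fromℕ< I-1<n)
              (trans (cong (_+ k) (length-points i₀)) (sym (2*m∸1∸j≡m+[m∸suc[j]] (toℕ<n j))))
    value : centre i₀ k ≡ entry n m d (rt i j 1≤i 1≤j)
    value = cong₂ (λ a b → rtval n a b , c n m d) (cong suc 1+i₀≡I) (m∸[m∸n]≡n (toℕ<n j))

  []=-R⁻ : ∀ {p w} → R n m d [ p ]= w → ∃ λ x → offset x ≡ p × w ≡ entry n m d x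
  []=-R⁻ {p} {w} q with []=-concat⁻ row row-length (subst (_[ p ]= w) R≡concat-rows q)
  ... | i , t , refl , q′ with []=-++⁻ (points i) q′
  ... | inj₁ q″ with []=-map⁻ _ q″
  ...   | _ , q‴ , refl with []=-tabulate⁻ (λ j → j) q‴
  ...     | j , refl , refl = r i j , refl , refl
  []=-R⁻ q | i , _ , refl , _ | inj₂ (k , refl , q″) with []=-centres⁻ i q″
  ... | nonlast , k<m∸1 , refl = x , index , value
    where
    suc[k]<m : suc k < m
    suc[k]<m = k<m∸1⇒suc[k]<m k<m∸1
    k<m : k < m
    k<m = <-trans (n<1+n k) suc[k]<m
    J<m : m ∸ suc k < m
    J<m = ∸-monoʳ-< (s≤s z≤n) (<⇒≤ suc[k]<m)
    1≤J : 1 ≤ m ∸ suc k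
    1≤J = m<n⇒0<n∸m suc[k]<m
    x : Elem n m
    x = rtAt nonlast J<m (s≤s z≤n) 1≤J
    index : offset x ≡ toℕ i * M + (length (points i) + k)
    index = trans (cong (encode M) (posKey-rtAt nonlast J<m (s≤s z≤n) 1≤J))
      (cong (λ t → toℕ i * M + t) (begin
        M ∸ (m ∸ suc k)                  ≡⟨ 2*m∸1∸j≡m+[m∸suc[j]] J<m ⟩
        m + (m ∸ suc (m ∸ suc k))        ≡⟨ cong (λ k → m + k) (m∸suc[m∸suc[k]]≡k k<m) ⟩
        m + k                            ≡⟨ cong (_+ k) (sym (length-points i)) ⟩
        length (points i) + k            ∎))
      where open ≡-Reasoning
    value : centre i k ≡ entry n m d x
    value = trans (cong (λ b → rtval n (2 + toℕ i) b , c n m d) (m∸k≡suc[m∸suc[k]] k<m))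
                  (sym (entry-rtAt nonlast J<m (s≤s z≤n) 1≤J))

  inner : Elem n m → Elem n m → List WInt
  inner q q′ = drop (suc (offset q)) (take (offset q′) (R n m d))

  segment≡ : ∀ {q q′} → pos q < pos q′ →
             segment (R n m d) (pos q) (pos q′) ≡ entry n m d q ∷ inner q q′ ++ [ entry n m d q′ ]
  segment≡ {q} {q′} lt rewrite pos≡ q | pos≡ q′ = drop-take-[]= ([]=-R⁺ q) ([]=-R⁺ q′) (s<s⁻¹ lt)

  ∈-inner⁻ : ∀ {q q′ w} → w ∈ inner q q′ → ∃ λ x → pos q < pos x × pos x < pos q′ × w ≡ entry n m d x
  ∈-inner⁻ {q} {q′} w∈ with ∈-drop-take⁻ (R n m d) (suc (offset q)) (offset q′) w∈
  ... | k , q<k , k<q′ , p with []=-R⁻ p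
  ... | x , refl , w≡ =
    x , subst₂ _<_ (sym (pos≡ q)) (sym (pos≡ x)) (s≤s q<k) ,
        subst₂ _<_ (sym (pos≡ x)) (sym (pos≡ q′)) (s≤s k<q′) , w≡

  ∈-inner⁺ : ∀ {q q′ x} → pos q < pos x → pos x < pos q′ → entry n m d x ∈ inner q q′
  ∈-inner⁺ {q} {q′} {x} q<x x<q′ =
    ∈-drop-take⁺ (suc (offset q)) (offset q′) ([]=-R⁺ x)
      (s<s⁻¹ (subst₂ _<_ (pos≡ q) (pos≡ x) q<x)) (s<s⁻¹ (subst₂ _<_ (pos≡ x) (pos≡ q′) x<q′))

  -- Adjacent pairs

  data Adjacent : Elem n m → Elem n m → Set where
    right       : ∀ {i j i′ j′} → toℕ i′ ≡ toℕ i → toℕ j′ ≡ suc (toℕ j) → Adjacent (r i j) (r i′ j′)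
    down        : ∀ {i j i′ j′} → toℕ i′ ≡ suc (toℕ i) → toℕ j′ ≡ toℕ j → Adjacent (r i j) (r i′ j′)
    to-centre   : ∀ {i j i′ j′ p q} → toℕ i′ ≡ suc (toℕ i) → toℕ j′ ≡ suc (toℕ j) →
                  Adjacent (r i j) (rt i′ j′ p q)
    from-centre : ∀ {i j i′ j′ p q} → toℕ i′ ≡ toℕ i → toℕ j′ ≡ toℕ j → Adjacent (rt i j p q) (r i′ j′)

  Separated : Elem n m → Elem n m → Set
  Separated q q′ = val q < val q′ ×
    (∀ x → pos q < pos x → pos x < pos q′ → val x < val q ⊎ val q′ < val x)

  Unobstructed : Elem n m → Elem n m → Set
  Unobstructed q q′ = val q < val q′ ×
    (∀ x → pos q < pos x → pos x < pos q′ → val q < val x → val x < val q′ → ⊥)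

  pos-suc⇒separated : ∀ q q′ → val q < val q′ → pos q′ ≡ suc (pos q) → Separated q q′
  pos-suc⇒separated q q′ q<q′ q′≡ =
    q<q′ , λ x q<x x<q′ → ⊥-elim (<⇒≱ q<x (s≤s⁻¹ (subst (_ <_) q′≡ x<q′)))

  val-suc⇒separated : ∀ q q′ → val q′ ≡ suc (val q) → Separated q q′
  val-suc⇒separated q q′ q′≡ = subst (val q <_) (sym q′≡) ≤-refl , outside
    where
    outside : ∀ x → pos q < pos x → pos x < pos q′ → val x < val q ⊎ val q′ < val x
    outside x q<x x<q′ with <-cmp (val x) (val q) | <-cmp (val x) (val q′)
    ... | tri< x<q _ _ | _            = inj₁ x<q
    ... | tri≈ _ x≡q _ | _            = ⊥-elim (<-irrefl (sym (val-injective x q x≡q)) q<x)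
    ... | tri> _ _ _   | tri≈ _ x≡q′ _ = ⊥-elim (<-irrefl (val-injective x q′ x≡q′) x<q′)
    ... | tri> _ _ _   | tri> _ _ q′<x = inj₂ q′<x
    ... | tri> _ _ q<x | tri< x<q′ _ _ = ⊥-elim (<⇒≱ q<x (s≤s⁻¹ (subst (_ <_) q′≡ x<q′)))

  adjacent⇒separated : ∀ {q q′} → Adjacent q q′ → Separated q q′
  adjacent⇒separated {r i j} {r i′ j′} (right i′≡i j′≡1+j) =
    pos-suc⇒separated (r i j) (r i′ j′)
      (valKey<⇒val< (r i j) (r i′ j′) (inj₁ (subst (toℕ j <_) (sym j′≡1+j) ≤-refl)))
      (trans (pos≡ (r i′ j′)) (cong₂ (λ a b → suc (a * M + b)) i′≡i j′≡1+j))
  adjacent⇒separated {r i j} {r i′ j′} (down i′≡1+i j′≡j) =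
    val-suc⇒separated (r i j) (r i′ j′)
      (trans (val≡ (r i′ j′)) (cong₂ (λ a b → suc (a * N + b)) j′≡j i′≡1+i))
  adjacent⇒separated {r i j} {q′@(rt i′ j′ _ 1≤j′)} (to-centre i′≡1+i j′≡1+j) =
    valKey<⇒val< (r i j) q′ (inj₂ (J≡j′-1 , <-≤-trans (toℕ<n i) (n≤N∸i i′))) , outside
    where
    J≡j′-1 : toℕ j ≡ pred (toℕ j′)
    J≡j′-1 = sym (cong pred j′≡1+j)
    above : ∀ x → (toℕ i , toℕ j) <ₗₑₓ posKey x → posKey x <ₗₑₓ (toℕ i , M ∸ toℕ j′) →
            valKey q′ <ₗₑₓ valKey x
    above (r _ j″) u v with <ₗₑₓ-sandwich u v
    ... | _ , j<j″ , _ = inj₁ (subst (_< toℕ j″) J≡j′-1 j<j″)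
    above (rt _ j″ _ _) u v with <ₗₑₓ-sandwich u v
    ... | _ , _ , lt = inj₁ (pred-mono-< {{>-nonZero 1≤j′}} (∸-cancelʳ-< {toℕ j″} {toℕ j′} lt))
    outside : ∀ x → pos (r i j) < pos x → pos x < pos q′ → val x < val (r i j) ⊎ val q′ < val x
    outside x q<x x<q′ = inj₂ (valKey<⇒val< q′ x (above x (pos<⇒posKey< (r i j) x q<x)
      (subst (λ a → posKey x <ₗₑₓ (a , M ∸ toℕ j′)) (cong pred i′≡1+i) (pos<⇒posKey< x q′ x<q′))))
  adjacent⇒separated {q@(rt i j 1≤i 1≤j)} {r i′ j′} (from-centre i′≡i j′≡j) =
    valKey<⇒val< q (r i′ j′) (inj₁ (subst (pred (toℕ j) <_) (sym j′≡j) (pred[n]<n 1≤j))) , outside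
    where
    below : ∀ x → (pred (toℕ i) , M ∸ toℕ j) <ₗₑₓ posKey x → posKey x <ₗₑₓ (toℕ i , toℕ j) →
            valKey x <ₗₑₓ valKey q
    below (r i″ j″) (inj₂ (_ , lt)) _ = ⊥-elim (<⇒≱ lt (≤-trans (<⇒≤ (toℕ<n j″)) (m≤M∸j j)))
    below (r i″ j″) (inj₁ lt) (inj₁ gt) = ⊥-elim (<⇒≱ lt (<⇒≤pred gt))
    below (r i″ j″) (inj₁ _) (inj₂ (_ , j″<j)) = ≤∧<⇒<ₗₑₓ (<⇒≤pred j″<j) (<-≤-trans (toℕ<n i″) (n≤N∸i i))
    below (rt i″ j″ _ _) _ (inj₂ (_ , lt)) = ⊥-elim (<⇒≱ lt (≤-trans (<⇒≤ (toℕ<n j)) (m≤M∸j j″)))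
    below (rt i″ j″ _ _) (inj₁ lt) (inj₁ gt) =
      ⊥-elim (<⇒≱ gt (<⇒≤pred (pred-cancel-< {toℕ i} {toℕ i″} lt)))
    below (rt i″ j″ _ 1≤j″) (inj₂ (_ , lt)) (inj₁ _) =
      inj₁ (pred-mono-< {{>-nonZero 1≤j″}} (∸-cancelʳ-< {toℕ j} {toℕ j″} lt))
    outside : ∀ x → pos q < pos x → pos x < pos (r i′ j′) → val x < val q ⊎ val (r i′ j′) < val x
    outside x q<x x<q′ = inj₁ (valKey<⇒val< x q (below x (pos<⇒posKey< q x q<x)
      (subst₂ (λ a b → posKey x <ₗₑₓ (a , b)) i′≡i j′≡j (pos<⇒posKey< x (r i′ j′) x<q′))))

  obstruction : ∀ q q′ → Unobstructed q q′ → ∀ x →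
                posKey q <ₗₑₓ posKey x → valKey q <ₗₑₓ valKey x →
                posKey x <ₗₑₓ posKey q′ → valKey x <ₗₑₓ valKey q′ → ⊥
  obstruction q q′ (_ , unobstructed) x q<x q≺x x<q′ x≺q′ =
    unobstructed x (posKey<⇒pos< q x q<x) (posKey<⇒pos< x q′ x<q′)
                   (valKey<⇒val< q x q≺x) (valKey<⇒val< x q′ x≺q′)

  point-obstruction : ∀ q q′ → Unobstructed q q′ → ∀ {I J} → I < n → J < m →
                      posKey q <ₗₑₓ (I , J) → valKey q <ₗₑₓ (J , I) →
                      (I , J) <ₗₑₓ posKey q′ → (J , I) <ₗₑₓ valKey q′ → ⊥
  point-obstruction q q′ u {I} {J} I<n J<m =
    subst₂ Between (toℕ-fromℕ< I<n) (toℕ-fromℕ< J<m) (obstruction q q′ u (r (fromℕ< I<n) (fromℕ< J<m)))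
    where
    Between : ℕ → ℕ → Set
    Between a b = posKey q <ₗₑₓ (a , b) → valKey q <ₗₑₓ (b , a) →
                  (a , b) <ₗₑₓ posKey q′ → (b , a) <ₗₑₓ valKey q′ → ⊥

  right-neighbour-obstructs : ∀ {i j} q′ → Unobstructed (r i j) q′ → suc (toℕ j) < m →
    (toℕ i , suc (toℕ j)) <ₗₑₓ posKey q′ → (suc (toℕ j) , toℕ i) <ₗₑₓ valKey q′ → ⊥
  right-neighbour-obstructs {i} {j} q′ u 1+j<m =
    point-obstruction (r i j) q′ u (toℕ<n i) 1+j<m (inj₂ (refl , ≤-refl)) (inj₁ ≤-refl)

  lower-neighbour-obstructs : ∀ {i j} q′ → Unobstructed (r i j) q′ → suc (toℕ i) < n →
    (suc (toℕ i) , toℕ j) <ₗₑₓ posKey q′ → (toℕ j , suc (toℕ i)) <ₗₑₓ valKey q′ → ⊥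
  lower-neighbour-obstructs {i} {j} q′ u 1+i<n =
    point-obstruction (r i j) q′ u 1+i<n (toℕ<n j) (inj₁ ≤-refl) (inj₂ (refl , ≤-refl))

  unobstructed⇒adjacent : ∀ q q′ → pos q < pos q′ → Unobstructed q q′ → Adjacent q q′
  unobstructed⇒adjacent q@(r i j) q′@(r i′ j′) q<q′ u
    with pos<⇒posKey< q q′ q<q′ | val<⇒valKey< q q′ (proj₁ u)
  ... | inj₂ (i≡i′ , j<j′) | _ with m≤n⇒m<n∨m≡n j<j′
  ...   | inj₂ 1+j≡j′ = right (sym i≡i′) (sym 1+j≡j′)
  ...   | inj₁ 1+j<j′ = ⊥-elim (right-neighbour-obstructs q′ u (<-trans 1+j<j′ (toℕ<n j′))
                          (inj₂ (i≡i′ , 1+j<j′)) (inj₁ 1+j<j′))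
  unobstructed⇒adjacent q@(r i j) q′@(r i′ j′) q<q′ u | inj₁ i<i′ | inj₂ (j≡j′ , _)
    with m≤n⇒m<n∨m≡n i<i′
  ... | inj₂ 1+i≡i′ = down (sym 1+i≡i′) (sym j≡j′)
  ... | inj₁ 1+i<i′ = ⊥-elim (lower-neighbour-obstructs q′ u (<-trans 1+i<i′ (toℕ<n i′))
                        (inj₁ 1+i<i′) (inj₂ (j≡j′ , 1+i<i′)))
  unobstructed⇒adjacent q@(r i j) q′@(r i′ j′) q<q′ u | inj₁ i<i′ | inj₁ j<j′ =
    ⊥-elim (right-neighbour-obstructs q′ u (≤-<-trans j<j′ (toℕ<n j′)) (inj₁ i<i′) (≤∧<⇒<ₗₑₓ j<j′ i<i′))
  unobstructed⇒adjacent q@(r i j) q′@(rt i′ j′ 1≤i′ 1≤j′) q<q′ u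
    with pos<⇒posKey< q q′ q<q′ | val<⇒valKey< q q′ (proj₁ u)
  ... | q<ₚq′ | inj₁ j<j′-1 =
    ⊥-elim (right-neighbour-obstructs q′ u 1+j<m (<ₗₑₓ-sndˡ q<ₚq′ (<-≤-trans 1+j<m (m≤M∸j j′)))
      (≤∧<⇒<ₗₑₓ j<j′-1 (<-≤-trans (toℕ<n i) (n≤N∸i i′))))
    where
    1+j<m : suc (toℕ j) < m
    1+j<m = ≤-<-trans j<j′-1 (<-trans (pred[n]<n 1≤j′) (toℕ<n j′))
  ... | inj₂ (i≡i′-1 , _) | inj₂ (j≡j′-1 , _) =
    to-centre (pred-inverse 1≤i′ i≡i′-1) (pred-inverse 1≤j′ j≡j′-1)
  ... | inj₁ i<i′-1 | inj₂ (j≡j′-1 , _) =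
    ⊥-elim (lower-neighbour-obstructs q′ u 1+i<n (≤∧<⇒<ₗₑₓ i<i′-1 (<-≤-trans (toℕ<n j) (m≤M∸j j′)))
      (inj₂ (j≡j′-1 , <-≤-trans 1+i<n (n≤N∸i i′))))
    where
    1+i<n : suc (toℕ i) < n
    1+i<n = ≤-<-trans i<i′-1 (<-trans (pred[n]<n 1≤i′) (toℕ<n i′))
  unobstructed⇒adjacent q@(rt i j 1≤i 1≤j) q′@(r i′ j′) q<q′ u
    with pos<⇒posKey< q q′ q<q′ | val<⇒valKey< q q′ (proj₁ u)
  ... | inj₂ (_ , lt) | _ = ⊥-elim (<⇒≱ lt (≤-trans (<⇒≤ (toℕ<n j′)) (m≤M∸j j)))
  ... | inj₁ _ | inj₂ (_ , lt) = ⊥-elim (<⇒≱ lt (≤-trans (<⇒≤ (toℕ<n i′)) (n≤N∸i i)))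
  ... | inj₁ i-1<i′ | inj₁ j-1<j′ =
    corner (m≤n⇒m<n∨m≡n (pred<⇒≤ 1≤i i-1<i′)) (m≤n⇒m<n∨m≡n (pred<⇒≤ 1≤j j-1<j′))
    where
    blocked : (toℕ i , toℕ j) <ₗₑₓ (toℕ i′ , toℕ j′) → (toℕ j , toℕ i) <ₗₑₓ (toℕ j′ , toℕ i′) → ⊥
    blocked = obstruction q q′ u (r i j) (inj₁ (pred[n]<n 1≤i)) (inj₁ (pred[n]<n 1≤j))
    corner : toℕ i < toℕ i′ ⊎ toℕ i ≡ toℕ i′ → toℕ j < toℕ j′ ⊎ toℕ j ≡ toℕ j′ → Adjacent q q′
    corner (inj₂ i≡i′) (inj₂ j≡j′) = from-centre (sym i≡i′) (sym j≡j′)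
    corner (inj₁ i<i′) (inj₁ j<j′) = ⊥-elim (blocked (inj₁ i<i′) (inj₁ j<j′))
    corner (inj₁ i<i′) (inj₂ j≡j′) = ⊥-elim (blocked (inj₁ i<i′) (inj₂ (j≡j′ , i<i′)))
    corner (inj₂ i≡i′) (inj₁ j<j′) = ⊥-elim (blocked (inj₂ (i≡i′ , j<j′)) (inj₁ j<j′))
  unobstructed⇒adjacent q@(rt i j 1≤i 1≤j) q′@(rt i′ j′ 1≤i′ 1≤j′) q<q′ u
    with pos<⇒posKey< q q′ q<q′ | val<⇒valKey< q q′ (proj₁ u)
  ... | inj₂ (_ , lt) | inj₁ v =
    ⊥-elim (<-asym (∸-cancelʳ-< {toℕ j} {toℕ j′} lt) (pred-cancel-< {toℕ j} {toℕ j′} v))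
  ... | inj₂ (e , _) | inj₂ (_ , lt) =
    ⊥-elim (<-irrefl (sym (pred-injective {{>-nonZero 1≤i}} {{>-nonZero 1≤i′}} e))
                     (∸-cancelʳ-< {toℕ i} {toℕ i′} lt))
  ... | inj₁ v | inj₂ (_ , lt) =
    ⊥-elim (<-asym (pred-cancel-< {toℕ i} {toℕ i′} v) (∸-cancelʳ-< {toℕ i} {toℕ i′} lt))
  ... | inj₁ v | inj₁ w =
    ⊥-elim (obstruction q q′ u (r i j) (inj₁ (pred[n]<n 1≤i)) (inj₁ (pred[n]<n 1≤j))
      (≤∧<⇒<ₗₑₓ (<⇒≤pred (pred-cancel-< {toℕ i} {toℕ i′} v)) (<-≤-trans (toℕ<n j) (m≤M∸j j′)))
      (≤∧<⇒<ₗₑₓ (<⇒≤pred (pred-cancel-< {toℕ j} {toℕ j′} w)) (<-≤-trans (toℕ<n i) (n≤N∸i i′))))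

  -- The half-integer condition

  UnitStep : Elem n m → Elem n m → Set
  UnitStep q q′ = (+ (2 * ceilI n m d q) ≤ℤ twoI n m d q′)
                × (+ (2 * ceilJ n m d q) ≤ℤ twoJ n m d q′)
                × (((twoI n m d q′ -ℤ twoI n m d q) +ℤ (twoJ n m d q′ -ℤ twoJ n m d q)) ≡ + 2)

  doubleI doubleJ : Elem n m → ℕ
  doubleI (r i j)      = 2 * suc (toℕ i)
  doubleI (rt i j _ _) = suc (2 * toℕ i)
  doubleJ (r i j)      = 2 * suc (toℕ j)
  doubleJ (rt i j _ _) = suc (2 * toℕ j)

  twoI≡ : ∀ x → twoI n m d x ≡ + doubleI x
  twoI≡ (r i j)      = refl
  twoI≡ (rt i j _ _) = cong +_ (+-suc (toℕ i) (toℕ i + 0))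

  twoJ≡ : ∀ x → twoJ n m d x ≡ + doubleJ x
  twoJ≡ (r i j)      = refl
  twoJ≡ (rt i j _ _) = cong +_ (+-suc (toℕ j) (toℕ j + 0))

  NatUnitStep : Elem n m → Elem n m → Set
  NatUnitStep q q′ =
    Step (2 * ceilI n m d q) (2 * ceilJ n m d q) (doubleI q) (doubleJ q) (doubleI q′) (doubleJ q′)

  natUnitStep⇔unitStep : ∀ q q′ → NatUnitStep q q′ ⇔ UnitStep q q′
  natUnitStep⇔unitStep q q′ = mk⇔
    (λ (c₁ , c₂ , e) → subst (_ ≤ℤ_) (sym (twoI≡ q′)) (ℤ.+≤+ c₁) ,
                        subst (_ ≤ℤ_) (sym (twoJ≡ q′)) (ℤ.+≤+ c₂) ,
                        trans differences≡ (Equivalence.from differences⇔ e))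
    (λ (c₁ , c₂ , e) → drop‿+≤+ (subst (_ ≤ℤ_) (twoI≡ q′) c₁) ,
                        drop‿+≤+ (subst (_ ≤ℤ_) (twoJ≡ q′) c₂) ,
                        Equivalence.to differences⇔ (trans (sym differences≡) e))
    where
    differences⇔ : ((+ doubleI q′ -ℤ + doubleI q) +ℤ (+ doubleJ q′ -ℤ + doubleJ q) ≡ + 2)
                 ⇔ (doubleI q′ + doubleJ q′ ≡ 2 + (doubleI q + doubleJ q))
    differences⇔ = difference-sum≡2⇔ (doubleI q) (doubleJ q) (doubleI q′) (doubleJ q′)
    differences≡ : (twoI n m d q′ -ℤ twoI n m d q) +ℤ (twoJ n m d q′ -ℤ twoJ n m d q)
                 ≡ (+ doubleI q′ -ℤ + doubleI q) +ℤ (+ doubleJ q′ -ℤ + doubleJ q)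
    differences≡ = cong₂ _+ℤ_ (cong₂ _-ℤ_ (twoI≡ q′) (twoI≡ q)) (cong₂ _-ℤ_ (twoJ≡ q′) (twoJ≡ q))

  adjacent⇔natUnitStep : ∀ q q′ → Adjacent q q′ ⇔ NatUnitStep q q′
  adjacent⇔natUnitStep (r i j) (r i′ j′) = mk⇔
    (λ { (right i′≡i j′≡1+j) → from (inj₁ (i′≡i , j′≡1+j))
       ; (down i′≡1+i j′≡j)  → from (inj₂ (i′≡1+i , j′≡j)) })
    (Sum.[ uncurry right , uncurry down ] ∘ to)
    where open Equivalence (even-even-step⇔ (toℕ i) (toℕ j) (toℕ i′) (toℕ j′))
  adjacent⇔natUnitStep (r i j) (rt i′ j′ _ _) =
    mk⇔ (λ { (to-centre i′≡1+i j′≡1+j) → from (i′≡1+i , j′≡1+j) }) (uncurry to-centre ∘ to)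
    where open Equivalence (even-odd-step⇔ (toℕ i) (toℕ j) (toℕ i′) (toℕ j′))
  adjacent⇔natUnitStep (rt i j _ _) (r i′ j′) =
    mk⇔ (λ { (from-centre i′≡i j′≡j) → from (i′≡i , j′≡j) }) (uncurry from-centre ∘ to)
    where open Equivalence (odd-even-step⇔ (toℕ i) (toℕ j) (toℕ i′) (toℕ j′))
  adjacent⇔natUnitStep (rt i j _ _) (rt i′ j′ _ _) =
    mk⇔ (λ ()) (⊥-elim ∘ odd-odd-¬step (toℕ i) (toℕ j) (toℕ i′) (toℕ j′))

  maximal⇔adjacent : ∀ q q′ → pos q < pos q′ →
    IsMaximalIncreasing (entry n m d q ∷ entry n m d q′ ∷ []) (segment (R n m d) (pos q) (pos q′))
    ⇔ Adjacent q q′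
  maximal⇔adjacent q q′ q<q′ = mk⇔
    (unobstructed⇒adjacent q q′ q<q′ ∘ unobstructed ∘ subst (IsMaximalIncreasing _) (segment≡ q<q′))
    (subst (IsMaximalIncreasing _) (sym (segment≡ q<q′)) ∘ maximal ∘ adjacent⇒separated)
    where
    Maximal : Set
    Maximal = IsMaximalIncreasing (entry n m d q ∷ entry n m d q′ ∷ [])
                                  (entry n m d q ∷ inner q q′ ++ [ entry n m d q′ ])
    unobstructed : Maximal → Unobstructed q q′
    unobstructed max@(_ , q<q′ ∷ _ , _) = q<q′ , λ x q<x x<q′ →
      pair-maximal⁻ (inner q q′) max (∈-inner⁺ {q} {q′} {x} q<x x<q′)
    maximal : Separated q q′ → Maximal
    maximal (q<q′ , outside) = pair-maximal⁺ (inner q q′) q<q′ λ w∈ →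
      let x , q<x , x<q′ , w≡x = ∈-inner⁻ {q} {q′} w∈ in
      subst (λ w → proj₁ w < val q ⊎ val q′ < proj₁ w) (sym w≡x) (outside x q<x x<q′)

lemma2 : (n m : ℕ) → 1 ≤ n → 1 ≤ m → (d : Fin n → Fin m → ℕ) →
    (q q′ : Elem n m) → f n m d q < f n m d q′ →
    IsMaximalIncreasing (entry n m d q ∷ entry n m d q′ ∷ [])
                        (segment (R n m d) (f n m d q) (f n m d q′))
    ⇔ ((+ (2 * ceilI n m d q) ≤ℤ twoI n m d q′)
       × (+ (2 * ceilJ n m d q) ≤ℤ twoJ n m d q′)
       × (((twoI n m d q′ -ℤ twoI n m d q) +ℤ (twoJ n m d q′ -ℤ twoJ n m d q)) ≡ + 2))
lemma2 n m _ _ d q q′ q<q′ =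
  natUnitStep⇔unitStep q q′ ⇔-∘ (adjacent⇔natUnitStep q q′ ⇔-∘ maximal⇔adjacent q q′ q<q′)
  where open Grid n m d
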